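{- Let $d>4$ and equip $\mathbb R^d$ with the inversion $\iota(x_1,\dots,x_d)=\frac{(x_1,-x_2,\dots,-x_d)}{x_1^2+\cdots+x_d^2}$. Let $a=(0,1,1,\dots,1)\in\mathbb R^d$ and define $S_1=a$ and $S_{m+1}=a+\iota(S_m)$ for $m\ge1$ (so that $S_{m+1}=a+[a,\dots,a]$ with $m$ copies of $a$ inside the bracket, where $[a_1,\dots,a_m]=\iota(a_1+\iota(a_2+\cdots+\iota(a_m)))$). Then for every $m\ge1$, $S_m$ is defined and $S_m\neq0$; that is, $a+[a,\dots,a]\neq0$ for continued fractions of arbitrary length. -}

module Defs where

open import Data.Nat using (ℕ; zero; suc)
open import Data.Fin using (Fin; zero; suc)
open import Data.Rational using (ℚ; 0ℚ; 1ℚ; _+_; _*_; -_; 1/_; _≟_; ≢-nonZero)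
open import Data.Maybe using (Maybe; just; nothing; _>>=_)
open import Relation.Nullary using (yes; no)

-- Points of ℚ^d as functions Fin d → ℚ; coordinate x_1 is index zero.
-- All points in the problem have rational coordinates (a ∈ ℤ^d and ι
-- preserves ℚ^d), so working in ℚ^d computes exactly the same points as in ℝ^d.
Pt : ℕ → Set
Pt d = Fin d → ℚ

zeroPt : ∀ {d} → Pt d
zeroPt _ = 0ℚ

_⊕_ : ∀ {d} → Pt d → Pt d → Pt d
(x ⊕ y) i = x i + y i

normSq : ∀ d → Pt d → ℚ
normSq zero    x = 0ℚ
normSq (suc d) x = x zero * x zero + normSq d (λ i → x (suc i))

conj : ∀ {d} → Pt d → Pt d
conj x zero    = x zero
conj x (suc i) = - x (suc i)

ι : ∀ d → Pt d → Maybe (Pt d)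
ι d x with normSq d x ≟ 0ℚ
... | yes _  = nothing
... | no n≢0 = just (λ i → conj x i * (1/ normSq d x) {{≢-nonZero n≢0}})

aPt : ∀ {d} → Pt d
aPt zero    = 0ℚ
aPt (suc i) = 1ℚ

-- S m for m ≥ 1, indexed so that S' d k = S_{k+1}:
-- S_1 = a,  S_{m+1} = a + ι(S_m)  (nothing if some inversion is undefined)
S' : ∀ d → ℕ → Maybe (Pt d)
S' d zero    = just aPt
S' d (suc k) = S' d k >>= λ x → ι d x >>= λ y → just (aPt ⊕ y)

-- S d m = S_m (S d 0 is an unused junk value, equal to S_1)
S : ∀ d → ℕ → Maybe (Pt d)
S d zero    = S' d zero
S d (suc k) = S' d k

{-# OPTIONS --safe #-}
module Submission where

open import Defs
open import Data.Nat using (ℕ; zero; suc; _>_; _≥_; s≤s; z≤n)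
open import Data.Fin using (zero; suc)
open import Data.Rational
  using ( ℚ; 0ℚ; 1ℚ; ½; _+_; _*_; -_; _-_; 1/_; _<_; _≤_; _<?_; _≟_
        ; ≢-nonZero; >-nonZero; positive; nonNegative; nonPositive)
open import Data.Rational.Properties
open import Data.Maybe using (Maybe; just; _>>=_)
open import Data.Product using (∃; _×_; _,_)
open import Data.Sum using (inj₁; inj₂)
open import Relation.Nullary using (¬_; yes; no; contradiction)
open import Relation.Nullary.Decidable using (from-yes)
open import Relation.Binary.PropositionalEquality
  using (_≡_; _≢_; refl; sym; trans; cong; cong₂; subst; ≢-sym; module ≡-Reasoning)

-- Every S_m is a multiple q_m a. Since conj a = -a and |a|² = d - 1, the
-- inversion sends q a to -(1/((d-1) q)) a, so q_{m+1} = 1 - 1/((d-1) q_m).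
-- When d - 1 ≥ 4 the bound q_m > ½ makes the correction 1/((d-1) q_m) less
-- than ½, hence q_{m+1} > ½: the scalars never reach 0 and no inversion is
-- ever undefined.

_≈_·a : ∀ {n} → Pt (suc n) → ℚ → Set
v ≈ q ·a = v zero ≡ 0ℚ × (∀ i → v (suc i) ≡ q)

Multiple>½ : ∀ {n} → Pt (suc n) → Set
Multiple>½ v = ∃ λ q → ½ < q × v ≈ q ·a

a≈1·a : ∀ {n} → aPt {suc n} ≈ 1ℚ ·a
a≈1·a = refl , λ _ → refl

Multiple>½⇒≢0 : ∀ {n} {v : Pt (suc (suc n))} → Multiple>½ v → ¬ (∀ i → v i ≡ 0ℚ)
Multiple>½⇒≢0 (q , ½<q , _ , vₛ) v≡0 =
  <-irrefl (trans (sym (v≡0 (suc zero))) (vₛ zero)) (<-trans (positive⁻¹ ½) ½<q)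

square-nonNeg : ∀ p → 0ℚ ≤ p * p
square-nonNeg p with ≤-total 0ℚ p
... | inj₁ 0≤p = nonNegative⁻¹ _ {{nonNeg*nonNeg⇒nonNeg p {{nonNegative 0≤p}} p {{nonNegative 0≤p}}}}
-- despite its name, nonPos*nonPos⇒nonPos concludes NonNegative
... | inj₂ p≤0 = nonNegative⁻¹ _ {{nonPos*nonPos⇒nonPos p {{nonPositive p≤0}} p {{nonPositive p≤0}}}}

normSq-nonNeg : ∀ d (x : Pt d) → 0ℚ ≤ normSq d x
normSq-nonNeg zero    x = ≤-refl
normSq-nonNeg (suc d) x = +-mono-≤ (square-nonNeg (x zero)) (normSq-nonNeg d (λ i → x (suc i)))

normSq-cong : ∀ d {x y : Pt d} → (∀ i → x i ≡ y i) → normSq d x ≡ normSq d y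
normSq-cong zero    x≗y = refl
normSq-cong (suc d) x≗y =
  cong₂ _+_ (cong₂ _*_ (x≗y zero) (x≗y zero)) (normSq-cong d (λ i → x≗y (suc i)))

normSq-multiple : ∀ {n q} {v : Pt (suc n)} → v ≈ q ·a → normSq (suc n) v ≡ normSq n (λ _ → q)
normSq-multiple {n} {q} {v} (v₀ , vₛ) = begin
  normSq (suc n) v                 ≡⟨ cong₂ _+_ (cong₂ _*_ v₀ v₀) (normSq-cong n vₛ) ⟩
  0ℚ * 0ℚ + normSq n (λ _ → q)     ≡⟨ +-identityˡ _ ⟩
  normSq n (λ _ → q)               ∎
  where open ≡-Reasoning

½<q⇒q<q*q+q*q : ∀ {q} → ½ < q → q < q * q + q * q
½<q⇒q<q*q+q*q {q} ½<q = begin-strict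
  q              ≡⟨ *-identityʳ q ⟨
  q * 1ℚ         <⟨ *-monoʳ-<-pos q {{positive (<-trans (positive⁻¹ ½) ½<q)}} (+-mono-< ½<q ½<q) ⟩
  q * (q + q)    ≡⟨ *-distribˡ-+ q q q ⟩
  q * q + q * q  ∎
  where open ≤-Reasoning

q+q<normSq-const : ∀ {n q} → n ≥ 4 → ½ < q → q + q < normSq n (λ _ → q)
q+q<normSq-const {suc (suc (suc (suc n)))} {q} (s≤s (s≤s (s≤s (s≤s z≤n)))) ½<q = begin-strict
  q + q                         <⟨ +-mono-< (½<q⇒q<q*q+q*q ½<q) (½<q⇒q<q*q+q*q ½<q) ⟩
  (s + s) + (s + s)             ≡⟨ +-assoc s s (s + s) ⟩
  s + (s + (s + s))             ≡⟨ cong (λ t → s + (s + (s + t))) (+-identityʳ s) ⟨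
  s + (s + (s + (s + 0ℚ)))      ≤⟨ +-monoʳ-≤ s (+-monoʳ-≤ s (+-monoʳ-≤ s (+-monoʳ-≤ s
                                     (normSq-nonNeg n (λ _ → q))))) ⟩
  normSq (suc (suc (suc (suc n)))) (λ _ → q) ∎
  where
  open ≤-Reasoning
  s = q * q

½*[q+q]≡q : ∀ q → ½ * (q + q) ≡ q
½*[q+q]≡q q = begin
  ½ * (q + q)      ≡⟨ *-distribˡ-+ ½ q q ⟩
  ½ * q + ½ * q    ≡⟨ *-distribʳ-+ q ½ ½ ⟨
  1ℚ * q           ≡⟨ *-identityˡ q ⟩
  q                ∎
  where open ≡-Reasoning

q/N<½ : ∀ {q N} (N>0 : 0ℚ < N) → q + q < N → q * (1/ N) {{>-nonZero N>0}} < ½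
q/N<½ {q} {N} N>0 q+q<N = *-cancelʳ-<-nonNeg N {{nonNegative (<⇒≤ N>0)}} (begin-strict
  q * 1/N * N      ≡⟨ *-assoc q 1/N N ⟩
  q * (1/N * N)    ≡⟨ cong (q *_) (*-inverseˡ N {{>-nonZero N>0}}) ⟩
  q * 1ℚ           ≡⟨ *-identityʳ q ⟩
  q                ≡⟨ ½*[q+q]≡q q ⟨
  ½ * (q + q)      <⟨ *-monoʳ-<-pos ½ q+q<N ⟩
  ½ * N            ∎)
  where
  open ≤-Reasoning
  1/N = (1/ N) {{>-nonZero N>0}}

½<1-q/N : ∀ {q N} (N>0 : 0ℚ < N) → q + q < N → ½ < 1ℚ - q * (1/ N) {{>-nonZero N>0}}
½<1-q/N {q} N>0 q+q<N =
  -- the left-hand side 1ℚ - ½ of this monotonicity step computes to ½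
  +-monoʳ-< 1ℚ (neg-antimono-< (q/N<½ {q} N>0 q+q<N))

ι-defined : ∀ d (x : Pt d) (N≢0 : normSq d x ≢ 0ℚ) →
  ι d x ≡ just (λ i → conj x i * (1/ normSq d x) {{≢-nonZero N≢0}})
ι-defined d x N≢0 with normSq d x ≟ 0ℚ
... | yes N≡0 = contradiction N≡0 N≢0
... | no _    = refl

next : ∀ d → Pt d → Maybe (Pt d)
next d x = ι d x >>= λ y → just (aPt ⊕ y)

next-multiple : ∀ {n q} {v : Pt (suc n)} → v ≈ q ·a → (N≢0 : normSq (suc n) v ≢ 0ℚ) →
  ∃ λ v' → next (suc n) v ≡ just v' × v' ≈ (1ℚ - q * (1/ normSq (suc n) v) {{≢-nonZero N≢0}}) ·a
next-multiple {n} {q} {v} (v₀ , vₛ) N≢0 =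
  _ , cong (_>>= λ y → just (aPt ⊕ y)) (ι-defined (suc n) v N≢0) , first , rest
  where
  1/N = (1/ normSq (suc n) v) {{≢-nonZero N≢0}}
  first : 0ℚ + v zero * 1/N ≡ 0ℚ
  first = begin
    0ℚ + v zero * 1/N   ≡⟨ cong (λ t → 0ℚ + t * 1/N) v₀ ⟩
    0ℚ + 0ℚ * 1/N       ≡⟨ cong (0ℚ +_) (*-zeroˡ 1/N) ⟩
    0ℚ                  ∎
    where open ≡-Reasoning
  rest : ∀ i → 1ℚ + (- v (suc i)) * 1/N ≡ 1ℚ - q * 1/N
  rest i = cong (1ℚ +_) (trans (cong (λ t → - t * 1/N) (vₛ i)) (sym (neg-distribˡ-* q 1/N)))

next-Multiple>½ : ∀ {n} → n ≥ 4 → {v : Pt (suc n)} → Multiple>½ v →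
  ∃ λ v' → next (suc n) v ≡ just v' × Multiple>½ v'
next-Multiple>½ {n} n≥4 {v} (q , ½<q , v≈qa) =
  let v' , next≡v' , v'≈q'a = next-multiple {v = v} v≈qa (≢-sym (<⇒≢ N>0))
  in  v' , next≡v' , _ , ½<1-q/N {q} N>0 q+q<N , v'≈q'a
  where
  q+q<N : q + q < normSq (suc n) v
  q+q<N = subst (q + q <_) (sym (normSq-multiple {v = v} v≈qa)) (q+q<normSq-const n≥4 ½<q)
  0<q : 0ℚ < q
  0<q = <-trans (positive⁻¹ ½) ½<q
  N>0 : 0ℚ < normSq (suc n) v
  N>0 = <-trans (+-mono-< 0<q 0<q) q+q<N

S'-Multiple>½ : ∀ {n} → n ≥ 4 → ∀ k → ∃ λ (v : Pt (suc n)) → S' (suc n) k ≡ just v × Multiple>½ v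
S'-Multiple>½ n≥4 zero    = aPt , refl , 1ℚ , from-yes (½ <? 1ℚ) , a≈1·a
S'-Multiple>½ {n} n≥4 (suc k) =
  let v  , S'≡v    , v>½  = S'-Multiple>½ n≥4 k
      v' , next≡v' , v'>½ = next-Multiple>½ n≥4 {v} v>½
  in  v' , trans (cong (_>>= next (suc n)) S'≡v) next≡v' , v'>½

proposition5p2 : (d : ℕ) → d > 4 → (m : ℕ) → m ≥ 1 →
    ∃ λ (v : Pt d) → S d m ≡ just v × ¬ (∀ i → v i ≡ 0ℚ)
proposition5p2 (suc n@(suc _)) (s≤s n≥4) (suc k) _ =
  let v , S≡v , v>½ = S'-Multiple>½ n≥4 k
  in  v , S≡v , Multiple>½⇒≢0 v>½
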